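{- If an $(m,s,3)$-graph $G$ is admissible for sets of size at most $n$, then the $(m,7s,3)$-query scheme $\mathcal{T}_G$ is satisfiable for every set $S\subseteq[m]$ of size at most $n$.
   Context: $\lg$ is logarithm base 2. An $(m,s,t)$-graph is a bipartite graph $G$ with vertex sets $U=[m]$ and $V$, where $V$ is partitioned into $2^t-1$ disjoint sets $A_\sigma$, one for each binary string $\sigma$ of length at most $t-1$ (including the empty string), each of size $s$, and each $u\in U$ has exactly one edge to each $A_\sigma$. For $i=1,\dots,t$ let $V_i=\bigcup_{|\sigma|=i-1}A_\sigma$ and let $G_i$ be the subgraph induced by $U\cup V_i$. The query scheme $\mathcal{T}_G$ uses a memory of $(2^t-1)s$ bits indexed by $V$: for query $u$, if the first $i-1$ probes returned $\sigma\in\{0,1\}^{i-1}$, the $i$-th probe reads the location of the unique neighbour of $u$ in $A_\sigma$; the answer is Yes iff the last bit read is $1$. $\mathcal{T}_G$ is satisfiable for $S$ if some assignment of bits to the memory makes all queries ``Is $x\in S$?'' ($x\in[m]$) answered correctly. $\Gamma_H(R)$ denotes the set of neighbours of $R$ in a graph $H$ (and $\Gamma_H(y)=\Gamma_H(\{y\})$). An $(m,s,3)$-graph $G$ is admissible for sets of size at most $n$ if (P1) every $R\subseteq[m]$ with $|R|\le n+\lceil n\lg\frac{2m}{n}\rceil$ satisfies $|\Gamma_G(R)|\ge 5|R|$; and (P2) for every $S\subseteq[m]$ with $|S|\le n$ and every $R\subseteq[m]\setminus S$ with $|R|>\lceil n\lg\frac{2m}{n}\rceil$ there is $y\in R$ such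 that either $\Gamma_{G_3}(y)\cap\Gamma_{G_3}(S)=\emptyset$, or both $|\Gamma_{G_3}(y)\cap\Gamma_{G_3}(S)|=1$ and $|\Gamma_{G_1\cup G_2}(y)\cap\Gamma_{G_1\cup G_2}((R\cup S)\setminus\{y\})|\le 1$. -}

module Defs where

open import Data.Bool using (Bool; true; false)
open import Data.Nat using (ℕ; zero; suc; _+_; _*_; _^_; _≤_)
open import Data.Integer as ℤ using (ℤ; +_; -[1+_])
open import Data.Fin using (Fin)
open import Data.Fin.Properties using (any?; _≟_)
open import Data.Fin.Subset using (Subset; _∈_; _∩_; _∪_; _-_; ⁅_⁆; ∣_∣; _⊆_; ∁)
open import Data.Fin.Subset.Properties using (_∈?_)
open import Data.List using (List; []; _∷_; _++_; map)
open import Data.Nat.ListAction using (sum)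
open import Data.Vec using (tabulate)
open import Data.Product using (Σ; ∃; ∃-syntax; _×_; _,_)
open import Data.Sum using (_⊎_)
open import Relation.Nullary using (¬_; does)
open import Relation.Nullary.Decidable using (_×-dec_)
open import Relation.Binary.PropositionalEquality using (_≡_)
open import Function.Bundles using (_⇔_)

-- Binary strings of length at most t-1 = 2 (the index set of the parts A_σ).
data Str : Set where
  ε   : Str
  one : Bool → Str
  two : Bool → Bool → Str

layer1 layer2 layer3 layer12 allStr : List Str
layer1  = ε ∷ []
layer2  = one false ∷ one true ∷ []
layer3  = two false false ∷ two false true ∷ two true false ∷ two true true ∷ []
layer12 = layer1 ++ layer2
allStr  = layer12 ++ layer3

-- An (m,s,3)-graph: V is the disjoint union of the parts A_σ, each a copy of Fin s
-- (vertex (σ , j) with j : Fin s); since each u has exactly one edge into each A_σ,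
-- the graph is given by G σ u = the unique neighbour of u in A_σ.
Graph : ℕ → ℕ → Set
Graph m s = Str → Fin m → Fin s

-- A set of vertices of V = Σ Str (λ _ → Fin s), given part by part.
VSet : ℕ → Set
VSet s = Str → Subset s

img : ∀ {m s} → (Fin m → Fin s) → Subset m → Subset s
img f R = tabulate (λ j → does (any? (λ i → (i ∈? R) ×-dec (f i ≟ j))))

Γ : ∀ {m s} → Graph m s → Subset m → VSet s
Γ G R σ = img (G σ) R

_∩V_ : ∀ {s} → VSet s → VSet s → VSet s
(X ∩V Y) σ = X σ ∩ Y σ

-- Cardinality of the part of a vertex set X lying in the parts listed in H,
-- i.e. |X ∩ V(H)|.  With H = layer3 this is the neighbourhood in G_3, etc.
cardOn : ∀ {s} → List Str → VSet s → ℕ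
cardOn H X = sum (map (λ σ → ∣ X σ ∣) H)

-- Memory of (2^3 - 1)s = 7s bits indexed by V.
Memory : ℕ → Set
Memory s = Str → Fin s → Bool

answer : ∀ {m s} → Graph m s → Memory s → Fin m → Bool
answer G M u =
  let b₁ = M ε (G ε u)
      b₂ = M (one b₁) (G (one b₁) u)
  in M (two b₁ b₂) (G (two b₁ b₂) u)

Satisfiable : ∀ {m s} → Graph m s → Subset m → Set
Satisfiable {m} {s} G S =
  ∃[ M ] ((x : Fin m) → (answer G M x ≡ true) ⇔ (x ∈ S))

-- LgLe n m c  :⇔  n · lg(2m/n) ≤ c   (c ∈ ℤ), written without reals as
-- (2m)^n ≤ 2^c · n^n   (convention 0 · lg(·) = 0 for n = 0 comes out automatically).
LgLe : ℕ → ℕ → ℤ → Set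
LgLe n m (+ k)     = (2 * m) ^ n ≤ 2 ^ k * n ^ n
LgLe n m -[1+ k ]  = 2 ^ suc k * (2 * m) ^ n ≤ n ^ n

-- c = ⌈ n lg(2m/n) ⌉ : the least integer c with n lg(2m/n) ≤ c.
IsCeilNLg : ℕ → ℕ → ℤ → Set
IsCeilNLg n m c = LgLe n m c × ¬ LgLe n m (c ℤ.- ℤ.+ 1)

P1 : ∀ {m s} → Graph m s → ℕ → ℤ → Set
P1 {m} G n c =
  (R : Subset m) → + ∣ R ∣ ℤ.≤ + n ℤ.+ c → 5 * ∣ R ∣ ≤ cardOn allStr (Γ G R)

P2 : ∀ {m s} → Graph m s → ℕ → ℤ → Set
P2 {m} G n c =
  (S : Subset m) → ∣ S ∣ ≤ n →
  (R : Subset m) → R ⊆ ∁ S → c ℤ.< + ∣ R ∣ →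
  ∃[ y ] (y ∈ R ×
    (cardOn layer3 (Γ G ⁅ y ⁆ ∩V Γ G S) ≡ 0
     ⊎ (cardOn layer3 (Γ G ⁅ y ⁆ ∩V Γ G S) ≡ 1
        × cardOn layer12 (Γ G ⁅ y ⁆ ∩V Γ G ((R ∪ S) - y)) ≤ 1)))

Admissible : ∀ {m s} → Graph m s → ℕ → ℤ → Set
Admissible G n c = P1 G n c × P2 G n c

module Submission where

-- Peel the elements outside S off one at a time with P2 until at most c of them remain,
-- the core C. The at most n + c elements of S ∪ C then satisfy Hall's condition with
-- demand 5 by P1, so each of them owns 5 of its 7 cells. The answer of the depth-3 query
-- tree can be forced whenever at most 2 of its 7 cells are beyond our control (a writable
-- root needs one forceable subtree, a blocked root needs both), so these elements answer
-- correctly. A peeled y must answer No. By P2 at the moment of its removal, either none of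
-- its leaf cells meets Γ(S), and all its leaves can be written 0, or exactly one does and at
-- most one inner cell meets S or an element removed after y, so again at most 2 cells are
-- blocked. The writes never conflict: an inner cell is written by one element only, and two
-- different elements writing the same leaf both lie outside S, so both write 0.

open import Defs
open import Data.Bool using (Bool; true; false; not; _∧_; _∨_; if_then_else_)
open import Data.Bool.Properties using (∧-conicalˡ; ∧-conicalʳ; ∨-zeroʳ) renaming (_≟_ to _≟ᵇ_)
open import Data.Nat
  using (ℕ; zero; suc; pred; _+_; _*_; _∸_; _≤_; _<_; z≤n; s≤s; _≤?_; _<?_; >-nonZero)
open import Data.Nat.Properties
open import Algebra.Properties.CommutativeSemigroup +-commutativeSemigroup using (x∙yz≈y∙xz)
open import Data.Integer as ℤ using (ℤ)
import Data.Integer.Properties as ℤₚ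
open import Data.Fin using (Fin; zero; suc; combine; remQuot)
open import Data.Fin.Patterns using (0F; 1F; 2F; 3F; 4F; 5F; 6F)
open import Data.Fin.Properties using (any?; combine-remQuot) renaming (_≟_ to _≟ᶠ_)
open import Data.Fin.Subset
open import Data.Fin.Subset.Properties
open import Data.Vec as Vec using (Vec; []; _∷_; here; there; lookup)
open import Data.Vec.Properties
  using ([]=⇒lookup; lookup⇒[]=; lookup-concat; lookup-map; lookup∘tabulate)
open import Data.Product using (∃; ∃₂; _×_; _,_; proj₁; proj₂; uncurry)
open import Data.Sum using (_⊎_; inj₁; inj₂; [_,_]′)
open import Data.Empty using (⊥-elim)
open import Data.List using (List; []; _∷_; _++_; map; length)
open import Data.List.Properties using (map-++; map-cong)
open import Data.List.Membership.Propositional using () renaming (_∈_ to _∈ˡ_)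
import Data.List.Relation.Unary.Any as Any
open import Data.Nat.ListAction using (sum)
open import Data.Nat.ListAction.Properties using (sum-++)
open import Data.Nat.Solver using (module +-*-Solver)
open import Function using (_∘_; id)
open import Relation.Nullary using (¬_; Dec; yes; no; does; contradiction)
open import Relation.Nullary.Decidable using (_×-dec_; dec-true; does-⇔)
open import Relation.Binary.PropositionalEquality
open import Function.Bundles using (mk⇔)

from-does : ∀ {A : Set} (a? : Dec A) → does a? ≡ true → A
from-does (yes a) _ = a

x∈p─q⇒x∉q : ∀ {n} {x : Fin n} (p q : Subset n) → x ∈ p ─ q → x ∉ q
x∈p─q⇒x∉q (inside ∷ p) (outside ∷ q) here ()
x∈p─q⇒x∉q (_ ∷ p) (_ ∷ q) (there x∈p─q) (there x∈q) = x∈p─q⇒x∉q p q x∈p─q x∈q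

x∈p-y⇒x≢y : ∀ {n} {x y : Fin n} (p : Subset n) → x ∈ p - y → x ≢ y
x∈p-y⇒x≢y {y = y} p x∈ = x∉⁅y⁆⇒x≢y (x∈p─q⇒x∉q p ⁅ y ⁆ x∈)

x∉p─p : ∀ {n} {x : Fin n} (p : Subset n) → x ∉ p ─ p
x∉p─p p x∈ = x∈p─q⇒x∉q p p x∈ (p─q⊆p p p x∈)

∩-mono : ∀ {n} {p p′ q q′ : Subset n} → p ⊆ p′ → q ⊆ q′ → p ∩ q ⊆ p′ ∩ q′
∩-mono {p = p} {q = q} p⊆p′ q⊆q′ x∈ with x∈p∩q⁻ p q x∈
... | x∈p , x∈q = x∈p∩q⁺ (p⊆p′ x∈p , q⊆q′ x∈q)

x∈p⇒⁅x⁆⊆p : ∀ {n} {x : Fin n} {p : Subset n} → x ∈ p → ⁅ x ⁆ ⊆ p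
x∈p⇒⁅x⁆⊆p {x = x} {p} x∈p y∈ = subst (_∈ p) (sym (x∈⁅y⁆⇒x≡y x y∈)) x∈p

x∈p⇒0<∣p∣ : ∀ {n} {x : Fin n} {p : Subset n} → x ∈ p → 0 < ∣ p ∣
x∈p⇒0<∣p∣ {x = x} x∈p = subst (_≤ _) (∣⁅x⁆∣≡1 x) (p⊆q⇒∣p∣≤∣q∣ (x∈p⇒⁅x⁆⊆p x∈p))

0<∣p∣⇒Nonempty : ∀ {n} (p : Subset n) → 0 < ∣ p ∣ → Nonempty p
0<∣p∣⇒Nonempty (inside ∷ p) _ = zero , here
0<∣p∣⇒Nonempty (outside ∷ p) 0<∣p∣ with 0<∣p∣⇒Nonempty p 0<∣p∣
... | x , x∈p = suc x , there x∈p

∣p∪q∣+∣p∩q∣≡∣p∣+∣q∣ : ∀ {n} (p q : Subset n) → ∣ p ∪ q ∣ + ∣ p ∩ q ∣ ≡ ∣ p ∣ + ∣ q ∣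
∣p∪q∣+∣p∩q∣≡∣p∣+∣q∣ [] [] = refl
∣p∪q∣+∣p∩q∣≡∣p∣+∣q∣ (inside ∷ p) (inside ∷ q) = cong suc (begin
  ∣ p ∪ q ∣ + suc (∣ p ∩ q ∣) ≡⟨ +-suc (∣ p ∪ q ∣) (∣ p ∩ q ∣) ⟩
  suc (∣ p ∪ q ∣ + ∣ p ∩ q ∣)   ≡⟨ cong suc (∣p∪q∣+∣p∩q∣≡∣p∣+∣q∣ p q) ⟩
  suc (∣ p ∣ + ∣ q ∣)           ≡⟨ +-suc (∣ p ∣) (∣ q ∣) ⟨
  ∣ p ∣ + suc (∣ q ∣)           ∎)
  where open ≡-Reasoning
∣p∪q∣+∣p∩q∣≡∣p∣+∣q∣ (inside ∷ p) (outside ∷ q) = cong suc (∣p∪q∣+∣p∩q∣≡∣p∣+∣q∣ p q)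
∣p∪q∣+∣p∩q∣≡∣p∣+∣q∣ (outside ∷ p) (inside ∷ q) =
  trans (cong suc (∣p∪q∣+∣p∩q∣≡∣p∣+∣q∣ p q)) (sym (+-suc (∣ p ∣) (∣ q ∣)))
∣p∪q∣+∣p∩q∣≡∣p∣+∣q∣ (outside ∷ p) (outside ∷ q) = ∣p∪q∣+∣p∩q∣≡∣p∣+∣q∣ p q

∣p∪q∣≤∣p∣+∣q∣ : ∀ {n} (p q : Subset n) → ∣ p ∪ q ∣ ≤ ∣ p ∣ + ∣ q ∣
∣p∪q∣≤∣p∣+∣q∣ p q = subst (∣ p ∪ q ∣ ≤_) (∣p∪q∣+∣p∩q∣≡∣p∣+∣q∣ p q) (m≤m+n _ _)

∣p∪q∣≡∣p∣+∣q∣ : ∀ {n} (p q : Subset n) → Empty (p ∩ q) → ∣ p ∪ q ∣ ≡ ∣ p ∣ + ∣ q ∣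
∣p∪q∣≡∣p∣+∣q∣ {n} p q disjoint = begin
  ∣ p ∪ q ∣               ≡⟨ +-identityʳ _ ⟨
  ∣ p ∪ q ∣ + 0           ≡⟨ cong (∣ p ∪ q ∣ +_) (∣⊥∣≡0 n) ⟨
  ∣ p ∪ q ∣ + ∣ ⊥ {n} ∣   ≡⟨ cong (λ r → ∣ p ∪ q ∣ + ∣ r ∣) (Empty-unique disjoint) ⟨
  ∣ p ∪ q ∣ + ∣ p ∩ q ∣   ≡⟨ ∣p∪q∣+∣p∩q∣≡∣p∣+∣q∣ p q ⟩
  ∣ p ∣ + ∣ q ∣           ∎
  where open ≡-Reasoning

-- Weighted cardinalities

weight : ∀ {k} → (Fin k → ℕ) → Subset k → ℕ
weight d []            = 0
weight d (inside ∷ X)  = d zero + weight (d ∘ suc) X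
weight d (outside ∷ X) = weight (d ∘ suc) X

total : ∀ {k} → (Fin k → ℕ) → ℕ
total d = weight d ⊤

restrict : ∀ {k} → (Fin k → ℕ) → Subset k → Fin k → ℕ
restrict d X i = if lookup X i then d i else 0

restrict-∈ : ∀ {k} (d : Fin k → ℕ) {X i} → i ∈ X → restrict d X i ≡ d i
restrict-∈ d {X} {i} i∈X rewrite []=⇒lookup i∈X = refl

weight-cong : ∀ {k} {f g : Fin k → ℕ} (X : Subset k) →
              (∀ {i} → i ∈ X → f i ≡ g i) → weight f X ≡ weight g X
weight-cong []            f≗g = refl
weight-cong (inside ∷ X)  f≗g = cong₂ _+_ (f≗g here) (weight-cong X (f≗g ∘ there))
weight-cong (outside ∷ X) f≗g = weight-cong X (f≗g ∘ there)

weight-mono : ∀ {k} (d : Fin k → ℕ) {X Y : Subset k} → X ⊆ Y → weight d X ≤ weight d Y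
weight-mono d {[]}          {[]}          _   = z≤n
weight-mono d {inside ∷ X}  {inside ∷ Y}  X⊆Y =
  +-monoʳ-≤ (d zero) (weight-mono (d ∘ suc) (drop-∷-⊆ X⊆Y))
weight-mono d {inside ∷ X}  {outside ∷ Y} X⊆Y with () ← X⊆Y here
weight-mono d {outside ∷ X} {inside ∷ Y}  X⊆Y =
  m≤n⇒m≤o+n (d zero) (weight-mono (d ∘ suc) (drop-∷-⊆ X⊆Y))
weight-mono d {outside ∷ X} {outside ∷ Y} X⊆Y = weight-mono (d ∘ suc) (drop-∷-⊆ X⊆Y)

weight-⊥ : ∀ {k} (d : Fin k → ℕ) → weight d ⊥ ≡ 0
weight-⊥ {zero}  d = refl
weight-⊥ {suc k} d = weight-⊥ (d ∘ suc)

weight-⁅⁆ : ∀ {k} (d : Fin k → ℕ) i → weight d ⁅ i ⁆ ≡ d i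
weight-⁅⁆ d zero    = trans (cong (d zero +_) (weight-⊥ (d ∘ suc))) (+-identityʳ (d zero))
weight-⁅⁆ d (suc i) = weight-⁅⁆ (d ∘ suc) i

weight-const : ∀ {k} a (X : Subset k) → weight (λ _ → a) X ≡ a * ∣ X ∣
weight-const a []            = sym (*-zeroʳ a)
weight-const a (inside ∷ X)  = trans (cong (a +_) (weight-const a X)) (sym (*-suc a (∣ X ∣)))
weight-const a (outside ∷ X) = weight-const a X

weight-remove : ∀ {k} (d : Fin k → ℕ) {X : Subset k} {i} → i ∈ X →
                weight d X ≡ d i + weight d (X - i)
weight-remove d {inside ∷ X} here = cong (λ Y → d zero + weight (d ∘ suc) Y) (sym (p─⊥≡p X))
weight-remove d {inside ∷ X} {suc i} (there i∈X) =
  trans (cong (d zero +_) (weight-remove (d ∘ suc) i∈X))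
        (x∙yz≈y∙xz (d zero) (d (suc i)) (weight (d ∘ suc) (X - i)))
weight-remove d {outside ∷ X} (there i∈X) = weight-remove (d ∘ suc) i∈X

weight-restrict : ∀ {k} (d : Fin k → ℕ) (X Y : Subset k) →
                  weight (restrict d X) Y ≡ weight d (Y ∩ X)
weight-restrict d []            []            = refl
weight-restrict d (inside ∷ X)  (inside ∷ Y)  = cong (d zero +_) (weight-restrict (d ∘ suc) X Y)
weight-restrict d (inside ∷ X)  (outside ∷ Y) = weight-restrict (d ∘ suc) X Y
weight-restrict d (outside ∷ X) (inside ∷ Y)  = weight-restrict (d ∘ suc) X Y
weight-restrict d (outside ∷ X) (outside ∷ Y) = weight-restrict (d ∘ suc) X Y

weight-∪ : ∀ {k} (d : Fin k → ℕ) (X Y : Subset k) →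
           weight d (Y ∪ X) ≡ weight (restrict d (∁ X)) Y + weight d X
weight-∪ d []            []            = refl
weight-∪ d (inside ∷ X)  (inside ∷ Y)  = trans (cong (d zero +_) (weight-∪ (d ∘ suc) X Y))
  (x∙yz≈y∙xz (d zero) (weight (restrict (d ∘ suc) (∁ X)) Y) (weight (d ∘ suc) X))
weight-∪ d (inside ∷ X)  (outside ∷ Y) = trans (cong (d zero +_) (weight-∪ (d ∘ suc) X Y))
  (x∙yz≈y∙xz (d zero) (weight (restrict (d ∘ suc) (∁ X)) Y) (weight (d ∘ suc) X))
weight-∪ d (outside ∷ X) (inside ∷ Y)  = trans (cong (d zero +_) (weight-∪ (d ∘ suc) X Y))
  (sym (+-assoc (d zero) (weight (restrict (d ∘ suc) (∁ X)) Y) (weight (d ∘ suc) X)))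
weight-∪ d (outside ∷ X) (outside ∷ Y) = weight-∪ (d ∘ suc) X Y

-- Hall's theorem with demands: if every X carries weight at most ∣ N X ∩ A ∣, each i gets
-- d i private elements of N ⁅ i ⁆ ∩ A. By induction on the total demand: split at a tight
-- set X if there is one, otherwise give any element of N ⁅ i ⁆ ∩ A to some i with d i > 0.

module Hall {k r : ℕ} (N : Subset k → Subset r)
            (N-mono : ∀ {X Y} → X ⊆ Y → N X ⊆ N Y)
            (N-∪ : ∀ X Y → N (X ∪ Y) ⊆ N X ∪ N Y) where

  HallCondition : (Fin k → ℕ) → Subset r → Set
  HallCondition d A = ∀ X → weight d X ≤ ∣ N X ∩ A ∣

  record Assignment (d : Fin k → ℕ) (A : Subset r) : Set where
    field
      F          : Fin k → Subset r
      F⊆         : ∀ i → F i ⊆ N ⁅ i ⁆ ∩ A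
      d≤∣F∣      : ∀ i → d i ≤ ∣ F i ∣
      F-disjoint : ∀ {i j c} → c ∈ F i → c ∈ F j → i ≡ j

  Tight : (Fin k → ℕ) → Subset r → Subset k → Set
  Tight d A X = 0 < weight d X × weight d X < total d × ∣ N X ∩ A ∣ ≤ weight d X

  tight? : ∀ d A X → Dec (Tight d A X)
  tight? d A X = (0 <? weight d X) ×-dec ((weight d X <? total d) ×-dec (∣ N X ∩ A ∣ ≤? weight d X))

  Assigner : ℕ → Set
  Assigner D = ∀ d A → total d < D → HallCondition d A → Assignment d A

  split-tight : ∀ {D} → Assigner D → ∀ d A → total d ≤ D → HallCondition d A →
                ∀ X → Tight d A X → Assignment d A
  split-tight {D} assign d A total≤D hall X (0<wX , wX<total , tight) =
    record { F = F ; F⊆ = F⊆ ; d≤∣F∣ = d≤∣F∣ ; F-disjoint = F-disjoint }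
    where
    open ≤-Reasoning
    A₂ : Subset r
    A₂ = A ─ N X

    hall₁ : HallCondition (restrict d X) A
    hall₁ Y = begin
      weight (restrict d X) Y ≡⟨ weight-restrict d X Y ⟩
      weight d (Y ∩ X)        ≤⟨ hall (Y ∩ X) ⟩
      ∣ N (Y ∩ X) ∩ A ∣       ≤⟨ p⊆q⇒∣p∣≤∣q∣ (∩-mono (N-mono (p∩q⊆p Y X)) id) ⟩
      ∣ N Y ∩ A ∣             ∎

    N[Y∪X]∩A⊆ : ∀ Y → N (Y ∪ X) ∩ A ⊆ (N Y ∩ A₂) ∪ (N X ∩ A)
    N[Y∪X]∩A⊆ Y {c} c∈ with x∈p∩q⁻ (N (Y ∪ X)) A c∈ | c ∈? N X
    ... | _ , c∈A | yes c∈NX = x∈p∪q⁺ (inj₂ (x∈p∩q⁺ (c∈NX , c∈A)))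
    ... | c∈N , c∈A | no c∉NX = x∈p∪q⁺ (inj₁ (x∈p∩q⁺ (c∈NY , x∈p∧x∉q⇒x∈p─q c∈A c∉NX)))
      where
      c∈NY : c ∈ N Y
      c∈NY = [ id , (λ c∈NX → contradiction c∈NX c∉NX) ]′ (x∈p∪q⁻ (N Y) (N X) (N-∪ Y X c∈N))

    hall₂ : HallCondition (restrict d (∁ X)) A₂
    hall₂ Y = +-cancelʳ-≤ (weight d X) _ _ (begin
      weight (restrict d (∁ X)) Y + weight d X ≡⟨ weight-∪ d X Y ⟨
      weight d (Y ∪ X)                         ≤⟨ hall (Y ∪ X) ⟩
      ∣ N (Y ∪ X) ∩ A ∣                        ≤⟨ p⊆q⇒∣p∣≤∣q∣ (N[Y∪X]∩A⊆ Y) ⟩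
      ∣ (N Y ∩ A₂) ∪ (N X ∩ A) ∣               ≤⟨ ∣p∪q∣≤∣p∣+∣q∣ (N Y ∩ A₂) (N X ∩ A) ⟩
      ∣ N Y ∩ A₂ ∣ + ∣ N X ∩ A ∣               ≤⟨ +-monoʳ-≤ (∣ N Y ∩ A₂ ∣) tight ⟩
      ∣ N Y ∩ A₂ ∣ + weight d X                ∎)

    total₁<D : total (restrict d X) < D
    total₁<D = begin-strict
      total (restrict d X) ≡⟨ weight-restrict d X ⊤ ⟩
      weight d (⊤ ∩ X)     ≡⟨ cong (weight d) (∩-identityˡ X) ⟩
      weight d X           <⟨ wX<total ⟩
      total d              ≤⟨ total≤D ⟩
      D                    ∎

    total₂<D : total (restrict d (∁ X)) < D
    total₂<D = begin-strict
      total (restrict d (∁ X))              <⟨ m<m+n _ 0<wX ⟩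
      total (restrict d (∁ X)) + weight d X ≡⟨ weight-∪ d X ⊤ ⟨
      weight d (⊤ ∪ X)                      ≡⟨ cong (weight d) (∪-zeroˡ X) ⟩
      total d                               ≤⟨ total≤D ⟩
      D                                     ∎

    module Inside = Assignment (assign (restrict d X) A total₁<D hall₁)
    module Outside = Assignment (assign (restrict d (∁ X)) A₂ total₂<D hall₂)

    Inside-F⊆NX : ∀ {i c} → i ∈ X → c ∈ Inside.F i → c ∈ N X
    Inside-F⊆NX {i} i∈X c∈ = N-mono (x∈p⇒⁅x⁆⊆p i∈X) (proj₁ (x∈p∩q⁻ _ _ (Inside.F⊆ i c∈)))

    Outside-F∌NX : ∀ {j c} → c ∈ Outside.F j → c ∉ N X
    Outside-F∌NX {j} c∈ = x∈p─q⇒x∉q A (N X) (proj₂ (x∈p∩q⁻ _ _ (Outside.F⊆ j c∈)))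

    F : Fin k → Subset r
    F i with i ∈? X
    ... | yes _ = Inside.F i
    ... | no _  = Outside.F i

    F⊆ : ∀ i → F i ⊆ N ⁅ i ⁆ ∩ A
    F⊆ i with i ∈? X
    ... | yes _ = Inside.F⊆ i
    ... | no _  = ∩-mono id (p─q⊆p A (N X)) ∘ Outside.F⊆ i

    d≤∣F∣ : ∀ i → d i ≤ ∣ F i ∣
    d≤∣F∣ i with i ∈? X
    ... | yes i∈X = subst (_≤ ∣ Inside.F i ∣) (restrict-∈ d i∈X) (Inside.d≤∣F∣ i)
    ... | no i∉X  = subst (_≤ ∣ Outside.F i ∣) (restrict-∈ d (x∉p⇒x∈∁p i∉X)) (Outside.d≤∣F∣ i)

    F-disjoint : ∀ {i j c} → c ∈ F i → c ∈ F j → i ≡ j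
    F-disjoint {i} {j} c∈Fᵢ c∈Fⱼ with i ∈? X | j ∈? X
    ... | yes _   | yes _   = Inside.F-disjoint c∈Fᵢ c∈Fⱼ
    ... | yes i∈X | no _    = contradiction (Inside-F⊆NX i∈X c∈Fᵢ) (Outside-F∌NX c∈Fⱼ)
    ... | no _    | yes j∈X = contradiction (Inside-F⊆NX j∈X c∈Fⱼ) (Outside-F∌NX c∈Fᵢ)
    ... | no _    | no _    = Outside.F-disjoint c∈Fᵢ c∈Fⱼ

  grow : ∀ {D} → Assigner D → ∀ d A → total d ≤ D → HallCondition d A → (∀ X → ¬ Tight d A X) →
         ∀ i → 0 < d i → ∀ {c} → c ∈ N ⁅ i ⁆ ∩ A → Assignment d A
  grow {D} assign d A total≤D hall loose i 0<dᵢ {c} c∈ =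
    record { F = F ; F⊆ = F⊆ ; d≤∣F∣ = d≤∣F∣ ; F-disjoint = F-disjoint }
    where
    A′ : Subset r
    A′ = A - c

    d′ : Fin k → ℕ
    d′ j with j ≟ᶠ i
    ... | yes _ = pred (d j)
    ... | no _  = d j

    d′-≢ : ∀ {j} → j ≢ i → d′ j ≡ d j
    d′-≢ {j} j≢i with j ≟ᶠ i
    ... | yes j≡i = contradiction j≡i j≢i
    ... | no _    = refl

    suc-d′ᵢ : suc (d′ i) ≡ d i
    suc-d′ᵢ with i ≟ᶠ i
    ... | yes _   = suc-pred (d i) {{>-nonZero 0<dᵢ}}
    ... | no i≢i  = contradiction refl i≢i

    weight-d′-∈ : ∀ {Y} → i ∈ Y → suc (weight d′ Y) ≡ weight d Y
    weight-d′-∈ {Y} i∈Y = begin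
      suc (weight d′ Y)               ≡⟨ cong suc (weight-remove d′ i∈Y) ⟩
      suc (d′ i) + weight d′ (Y - i)
        ≡⟨ cong₂ _+_ suc-d′ᵢ (weight-cong (Y - i) (d′-≢ ∘ x∈p-y⇒x≢y Y)) ⟩
      d i + weight d (Y - i)          ≡⟨ weight-remove d i∈Y ⟨
      weight d Y                      ∎
      where open ≡-Reasoning

    weight-d′-∉ : ∀ {Y} → i ∉ Y → weight d′ Y ≡ weight d Y
    weight-d′-∉ {Y} i∉Y = weight-cong Y (λ j∈Y → d′-≢ (λ { refl → i∉Y j∈Y }))

    ∣X∩A∣≤1+∣X∩A′∣ : ∀ X → ∣ X ∩ A ∣ ≤ suc ∣ X ∩ A′ ∣
    ∣X∩A∣≤1+∣X∩A′∣ X = begin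
      ∣ X ∩ A ∣               ≤⟨ p⊆q⇒∣p∣≤∣q∣ X∩A⊆ ⟩
      ∣ (X ∩ A′) ∪ ⁅ c ⁆ ∣    ≤⟨ ∣p∪q∣≤∣p∣+∣q∣ (X ∩ A′) ⁅ c ⁆ ⟩
      ∣ X ∩ A′ ∣ + ∣ ⁅ c ⁆ ∣  ≡⟨ cong (∣ X ∩ A′ ∣ +_) (∣⁅x⁆∣≡1 c) ⟩
      ∣ X ∩ A′ ∣ + 1          ≡⟨ +-comm (∣ X ∩ A′ ∣) 1 ⟩
      suc ∣ X ∩ A′ ∣          ∎
      where
      open ≤-Reasoning
      X∩A⊆ : X ∩ A ⊆ (X ∩ A′) ∪ ⁅ c ⁆
      X∩A⊆ {x} x∈ with x∈p∩q⁻ X A x∈ | x ≟ᶠ c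
      ... | _ | yes refl = x∈p∪q⁺ (inj₂ (x∈⁅x⁆ c))
      ... | x∈X , x∈A | no x≢c = x∈p∪q⁺ (inj₁ (x∈p∩q⁺ (x∈X , x∈p∧x≢y⇒x∈p-y x∈A x≢c)))

    hall′ : HallCondition d′ A′
    hall′ Y with i ∈? Y
    ... | yes i∈Y = ≤-pred (begin
      suc (weight d′ Y) ≡⟨ weight-d′-∈ i∈Y ⟩
      weight d Y        ≤⟨ hall Y ⟩
      ∣ N Y ∩ A ∣       ≤⟨ ∣X∩A∣≤1+∣X∩A′∣ (N Y) ⟩
      suc ∣ N Y ∩ A′ ∣  ∎)
      where open ≤-Reasoning
    ... | no i∉Y = subst (_≤ ∣ N Y ∩ A′ ∣) (sym (weight-d′-∉ i∉Y)) wY≤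
      where
      wY<total : weight d Y < total d
      wY<total = begin-strict
        weight d Y             ≤⟨ weight-mono d Y⊆⊤-i ⟩
        weight d (⊤ - i)       <⟨ m<n+m _ 0<dᵢ ⟩
        d i + weight d (⊤ - i) ≡⟨ weight-remove d ∈⊤ ⟨
        total d                ∎
        where
        open ≤-Reasoning
        Y⊆⊤-i : Y ⊆ ⊤ - i
        Y⊆⊤-i j∈Y = x∈p∧x≢y⇒x∈p-y ∈⊤ λ { refl → i∉Y j∈Y }
      wY≤ : weight d Y ≤ ∣ N Y ∩ A′ ∣
      wY≤ with 0 <? weight d Y
      ... | no wY≯0  = subst (_≤ ∣ N Y ∩ A′ ∣) (sym (n≤0⇒n≡0 (≮⇒≥ wY≯0))) z≤n
      -- Y is not tight, so it can spare c.
      ... | yes 0<wY = ≤-pred (≤-trans (≰⇒> λ ∣NY∩A∣≤ → loose Y (0<wY , wY<total , ∣NY∩A∣≤))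
                                       (∣X∩A∣≤1+∣X∩A′∣ (N Y)))

    module Rec = Assignment (assign d′ A′ (subst (_≤ D) (sym (weight-d′-∈ ∈⊤)) total≤D) hall′)

    c∉Rec-F : ∀ j → c ∉ Rec.F j
    c∉Rec-F j c∈F = x∈p-y⇒x≢y A (proj₂ (x∈p∩q⁻ _ _ (Rec.F⊆ j c∈F))) refl

    c∈F : ∀ {x j} → x ∈ ⁅ c ⁆ → x ∈ Rec.F j → c ∈ Rec.F j
    c∈F {j = j} x∈⁅c⁆ = subst (_∈ Rec.F j) (x∈⁅y⁆⇒x≡y c x∈⁅c⁆)

    F : Fin k → Subset r
    F j with j ≟ᶠ i
    ... | yes _ = Rec.F j ∪ ⁅ c ⁆
    ... | no _  = Rec.F j

    F⊆ : ∀ j → F j ⊆ N ⁅ j ⁆ ∩ A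
    F⊆ j with j ≟ᶠ i
    ... | no _     = ∩-mono id (p─q⊆p A ⁅ c ⁆) ∘ Rec.F⊆ j
    ... | yes refl = λ x∈ → [ ∩-mono id (p─q⊆p A ⁅ c ⁆) ∘ Rec.F⊆ i
                            , (λ x∈⁅c⁆ → subst (_∈ N ⁅ i ⁆ ∩ A) (sym (x∈⁅y⁆⇒x≡y c x∈⁅c⁆)) c∈) ]′
                            (x∈p∪q⁻ (Rec.F i) ⁅ c ⁆ x∈)

    d≤∣F∣ : ∀ j → d j ≤ ∣ F j ∣
    d≤∣F∣ j with j ≟ᶠ i
    ... | no j≢i   = subst (_≤ ∣ Rec.F j ∣) (d′-≢ j≢i) (Rec.d≤∣F∣ j)
    ... | yes refl = begin
      d i                     ≡⟨ suc-d′ᵢ ⟨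
      suc (d′ i)              ≤⟨ s≤s (Rec.d≤∣F∣ i) ⟩
      suc ∣ Rec.F i ∣         ≡⟨ +-comm 1 (∣ Rec.F i ∣) ⟩
      ∣ Rec.F i ∣ + 1         ≡⟨ cong (∣ Rec.F i ∣ +_) (∣⁅x⁆∣≡1 c) ⟨
      ∣ Rec.F i ∣ + ∣ ⁅ c ⁆ ∣ ≡⟨ ∣p∪q∣≡∣p∣+∣q∣ (Rec.F i) ⁅ c ⁆ disjoint ⟨
      ∣ Rec.F i ∪ ⁅ c ⁆ ∣     ∎
      where
      open ≤-Reasoning
      disjoint : Empty (Rec.F i ∩ ⁅ c ⁆)
      disjoint (x , x∈) with x∈p∩q⁻ (Rec.F i) ⁅ c ⁆ x∈
      ... | x∈F′ , x∈⁅c⁆ = c∉Rec-F i (subst (_∈ Rec.F i) (x∈⁅y⁆⇒x≡y c x∈⁅c⁆) x∈F′)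

    F-disjoint : ∀ {j j′ x} → x ∈ F j → x ∈ F j′ → j ≡ j′
    F-disjoint {j} {j′} {x} x∈Fⱼ x∈Fⱼ′ with j ≟ᶠ i | j′ ≟ᶠ i
    ... | yes j≡i  | yes j′≡i = trans j≡i (sym j′≡i)
    ... | no _     | no _     = Rec.F-disjoint x∈Fⱼ x∈Fⱼ′
    ... | yes refl | no _     = [ (λ x∈F′ᵢ → Rec.F-disjoint x∈F′ᵢ x∈Fⱼ′)
                                , (λ x∈⁅c⁆ → contradiction (c∈F x∈⁅c⁆ x∈Fⱼ′) (c∉Rec-F j′)) ]′
                                (x∈p∪q⁻ (Rec.F i) ⁅ c ⁆ x∈Fⱼ)
    ... | no _     | yes refl = [ (λ x∈F′ᵢ → Rec.F-disjoint x∈Fⱼ x∈F′ᵢ)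
                                , (λ x∈⁅c⁆ → contradiction (c∈F x∈⁅c⁆ x∈Fⱼ) (c∉Rec-F j)) ]′
                                (x∈p∪q⁻ (Rec.F i) ⁅ c ⁆ x∈Fⱼ′)

  assign : ∀ D → Assigner D
  assign zero    d A () _
  assign (suc D) d A (s≤s total≤D) hall with anySubset? (tight? d A)
  ... | yes (X , tightX) = split-tight (assign D) d A total≤D hall X tightX
  ... | no loose with any? (λ i → 0 <? d i)
  ...   | yes (i , 0<dᵢ) =
    grow (assign D) d A total≤D hall (λ X t → loose (X , t)) i 0<dᵢ (proj₂ N⁅i⁆∩A-nonempty)
    where
    N⁅i⁆∩A-nonempty : Nonempty (N ⁅ i ⁆ ∩ A)
    N⁅i⁆∩A-nonempty = 0<∣p∣⇒Nonempty (N ⁅ i ⁆ ∩ A)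
      (≤-trans 0<dᵢ (subst (_≤ ∣ N ⁅ i ⁆ ∩ A ∣) (weight-⁅⁆ d i) (hall ⁅ i ⁆)))
  ...   | no no-demand = record
    { F = λ _ → ⊥
    ; F⊆ = λ _ → ⊥⊆
    ; d≤∣F∣ = λ i → subst (d i ≤_) (sym (∣⊥∣≡0 r)) (≮⇒≥ λ 0<dᵢ → no-demand (i , 0<dᵢ))
    ; F-disjoint = λ c∈⊥ → contradiction c∈⊥ ∉⊥
    }

  hall : ∀ d A → HallCondition d A → Assignment d A
  hall d A = assign (suc (total d)) d A ≤-refl

-- Vertex sets

∈-img⁺ : ∀ {m s} (f : Fin m → Fin s) {R i} → i ∈ R → f i ∈ img f R
∈-img⁺ f {R} {i} i∈R = lookup⇒[]= (f i) (img f R)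
  (trans (lookup∘tabulate _ (f i))
         (dec-true (any? (λ i′ → (i′ ∈? R) ×-dec (f i′ ≟ᶠ f i))) (i , i∈R , refl)))

∈-img⁻ : ∀ {m s} (f : Fin m → Fin s) {R j} → j ∈ img f R → ∃ λ i → i ∈ R × f i ≡ j
∈-img⁻ f {R} {j} j∈ = from-does (any? (λ i → (i ∈? R) ×-dec (f i ≟ᶠ j)))
  (trans (sym (lookup∘tabulate _ j)) ([]=⇒lookup j∈))

img-mono : ∀ {m s} (f : Fin m → Fin s) {R R′} → R ⊆ R′ → img f R ⊆ img f R′
img-mono f R⊆R′ j∈ with ∈-img⁻ f j∈
... | i , i∈R , refl = ∈-img⁺ f (R⊆R′ i∈R)

img-∪ : ∀ {m s} (f : Fin m → Fin s) (X Y : Subset m) → img f (X ∪ Y) ⊆ img f X ∪ img f Y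
img-∪ f X Y j∈ with ∈-img⁻ f j∈
... | i , i∈X∪Y , refl = x∈p∪q⁺ ([ inj₁ ∘ ∈-img⁺ f , inj₂ ∘ ∈-img⁺ f ]′ (x∈p∪q⁻ X Y i∈X∪Y))

img-⁅⁆ : ∀ {m s} (f : Fin m → Fin s) {i j} → j ∈ img f ⁅ i ⁆ → f i ≡ j
img-⁅⁆ f {i} j∈ with ∈-img⁻ f j∈
... | i′ , i′∈⁅i⁆ , refl = cong f (sym (x∈⁅y⁆⇒x≡y i i′∈⁅i⁆))

-- V, the disjoint union of the parts A_σ ≅ Fin s, is identified with Fin (7 * s) so that
-- Hall's theorem for subsets applies; cell σ j is the position of vertex j of A_σ.
allStrVec : Vec Str 7
allStrVec = Vec.fromList allStr

strIndex : Str → Fin 7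
strIndex ε                 = 0F
strIndex (one false)       = 1F
strIndex (one true)        = 2F
strIndex (two false false) = 3F
strIndex (two false true)  = 4F
strIndex (two true false)  = 5F
strIndex (two true true)   = 6F

lookup-strIndex : ∀ σ → lookup allStrVec (strIndex σ) ≡ σ
lookup-strIndex ε                 = refl
lookup-strIndex (one false)       = refl
lookup-strIndex (one true)        = refl
lookup-strIndex (two false false) = refl
lookup-strIndex (two false true)  = refl
lookup-strIndex (two true false)  = refl
lookup-strIndex (two true true)   = refl

strIndex-lookup : ∀ i → strIndex (lookup allStrVec i) ≡ i
strIndex-lookup 0F = refl
strIndex-lookup 1F = refl
strIndex-lookup 2F = refl
strIndex-lookup 3F = refl
strIndex-lookup 4F = refl
strIndex-lookup 5F = refl
strIndex-lookup 6F = refl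

flatten : ∀ {s} → VSet s → Subset (7 * s)
flatten X = Vec.concat (Vec.map X allStrVec)

cell : ∀ {s} → Str → Fin s → Fin (7 * s)
cell σ j = combine (strIndex σ) j

lookup-flatten : ∀ {s} (X : VSet s) σ j → lookup (flatten X) (cell σ j) ≡ lookup (X σ) j
lookup-flatten X σ j = begin
  lookup (flatten X) (cell σ j)
    ≡⟨ lookup-concat (Vec.map X allStrVec) (strIndex σ) j ⟩
  lookup (lookup (Vec.map X allStrVec) (strIndex σ)) j
    ≡⟨ cong (λ xs → lookup xs j) (lookup-map (strIndex σ) X allStrVec) ⟩
  lookup (X (lookup allStrVec (strIndex σ))) j
    ≡⟨ cong (λ τ → lookup (X τ) j) (lookup-strIndex σ) ⟩
  lookup (X σ) j
    ∎
  where open ≡-Reasoning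

∈-flatten⁺ : ∀ {s} (X : VSet s) {σ j} → j ∈ X σ → cell σ j ∈ flatten X
∈-flatten⁺ X {σ} {j} j∈ =
  lookup⇒[]= (cell σ j) (flatten X) (trans (lookup-flatten X σ j) ([]=⇒lookup j∈))

∈-flatten⁻ : ∀ {s} (X : VSet s) {σ j} → cell σ j ∈ flatten X → j ∈ X σ
∈-flatten⁻ X {σ} {j} c∈ =
  lookup⇒[]= j (X σ) (trans (sym (lookup-flatten X σ j)) ([]=⇒lookup c∈))

cell-surjective : ∀ {s} (c : Fin (7 * s)) → ∃₂ λ σ j → cell σ j ≡ c
cell-surjective {s} c with remQuot s c in eq
... | i , j = lookup allStrVec i , j ,
  trans (cong (λ i′ → combine i′ j) (strIndex-lookup i))
        (trans (cong (uncurry combine) (sym eq)) (combine-remQuot s c))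

flatten-mono : ∀ {s} {X Y : VSet s} → (∀ σ → X σ ⊆ Y σ) → flatten X ⊆ flatten Y
flatten-mono {s} {X} {Y} X⊆Y {c} c∈ with cell-surjective {s} c
... | σ , j , refl = ∈-flatten⁺ Y (X⊆Y σ (∈-flatten⁻ X c∈))

∣xs++ys∣≡∣xs∣+∣ys∣ : ∀ {m n} (xs : Subset m) (ys : Subset n) → ∣ xs Vec.++ ys ∣ ≡ ∣ xs ∣ + ∣ ys ∣
∣xs++ys∣≡∣xs∣+∣ys∣ []            ys = refl
∣xs++ys∣≡∣xs∣+∣ys∣ (inside ∷ xs)  ys = cong suc (∣xs++ys∣≡∣xs∣+∣ys∣ xs ys)
∣xs++ys∣≡∣xs∣+∣ys∣ (outside ∷ xs) ys = ∣xs++ys∣≡∣xs∣+∣ys∣ xs ys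

∣concat∣≡cardOn : ∀ {s} (H : List Str) (X : VSet s) →
                  ∣ Vec.concat (Vec.map X (Vec.fromList H)) ∣ ≡ cardOn H X
∣concat∣≡cardOn []      X = refl
∣concat∣≡cardOn (σ ∷ H) X =
  trans (∣xs++ys∣≡∣xs∣+∣ys∣ (X σ) _) (cong (∣ X σ ∣ +_) (∣concat∣≡cardOn H X))

∣flatten∣≡cardOn : ∀ {s} (X : VSet s) → ∣ flatten X ∣ ≡ cardOn allStr X
∣flatten∣≡cardOn = ∣concat∣≡cardOn allStr

-- Query trees

data Tree (A : Set) : ℕ → Set where
  leaf : A → Tree A zero
  node : ∀ {n} → A → Tree A n → Tree A n → Tree A (suc n)

query : ∀ {n} → Tree Bool n → Bool
query (leaf b)     = b
query (node b l r) = query (if b then r else l)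

indicator : Bool → ℕ
indicator true  = 1
indicator false = 0

-- As a mask, a tree of Bools marks with true the cells whose content we may choose.
blocked : ∀ {n} → Tree Bool n → ℕ
blocked (leaf w)     = indicator (not w)
blocked (node w l r) = indicator (not w) + (blocked l + blocked r)

forceable : ∀ {n} → Tree Bool n → Bool
forceable (leaf w)     = w
forceable (node w l r) = if w then forceable l ∨ forceable r else forceable l ∧ forceable r

plan : ∀ {n} → Tree Bool n → Bool → Tree Bool n
plan (leaf _)     v = leaf v
plan (node _ l r) v = node (not (forceable l)) (plan l v) (plan r v)

Agrees : ∀ {n} → Tree Bool n → Tree Bool n → Tree Bool n → Set
Agrees (leaf w)       (leaf p)       (leaf a)       = w ≡ true → a ≡ p
Agrees (node w wl wr) (node p pl pr) (node a al ar) =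
  (w ≡ true → a ≡ p) × Agrees wl pl al × Agrees wr pr ar

query-plan : ∀ {n} (w : Tree Bool n) v a → forceable w ≡ true → Agrees w (plan w v) a →
             query a ≡ v
query-plan (leaf w) v (leaf a) w≡true a≡v = a≡v w≡true
query-plan (node true l r) v (node a al ar) forceable-w (a≡ , agl , agr) with forceable l in fl
... | true  rewrite a≡ refl = query-plan l v al fl agl
... | false rewrite a≡ refl = query-plan r v ar forceable-w agr
query-plan (node false l r) v (node a al ar) forceable-w (_ , agl , agr) with a
... | true  = query-plan r v ar (∧-conicalʳ (forceable l) _ forceable-w) agr
... | false = query-plan l v al (∧-conicalˡ _ (forceable r) forceable-w) agl

m+n≤1+o⇒m≤o⊎n≤o : ∀ {m n o} → m + n ≤ suc o → m ≤ o ⊎ n ≤ o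
m+n≤1+o⇒m≤o⊎n≤o {m} {n} {o} m+n≤ with m ≤? o
... | yes m≤o = inj₁ m≤o
... | no m≰o  = inj₂ (≤-trans (+-cancelʳ-≤ (suc o) n 0 (begin
  n + suc o ≤⟨ +-monoʳ-≤ n (≰⇒> m≰o) ⟩
  n + m     ≡⟨ +-comm n m ⟩
  m + n     ≤⟨ m+n≤ ⟩
  suc o     ∎)) z≤n)
  where open ≤-Reasoning

few-blocked⇒forceable : ∀ {n} (w : Tree Bool n) → blocked w ≤ n → forceable w ≡ true
few-blocked⇒forceable (leaf true) _ = refl
few-blocked⇒forceable (leaf false) ()
few-blocked⇒forceable (node true l r) bl+br≤ with m+n≤1+o⇒m≤o⊎n≤o bl+br≤
... | inj₁ bl≤ rewrite few-blocked⇒forceable l bl≤ = refl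
... | inj₂ br≤ rewrite few-blocked⇒forceable r br≤ = ∨-zeroʳ (forceable l)
few-blocked⇒forceable (node false l r) (s≤s bl+br≤)
  rewrite few-blocked⇒forceable l (m+n≤o⇒m≤o _ bl+br≤)
        | few-blocked⇒forceable r (m+n≤o⇒n≤o (blocked l) bl+br≤) = refl

LeavesWritable : ∀ {n} → Tree Bool n → Set
LeavesWritable (leaf w)     = w ≡ true
LeavesWritable (node _ l r) = LeavesWritable l × LeavesWritable r

leaves-writable⇒forceable : ∀ {n} (w : Tree Bool n) → LeavesWritable w → forceable w ≡ true
leaves-writable⇒forceable (leaf w) w≡true = w≡true
leaves-writable⇒forceable (node w l r) (wl , wr)
  rewrite leaves-writable⇒forceable l wl | leaves-writable⇒forceable r wr with w
... | true  = refl
... | false = refl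

tree : ∀ {A : Set} → (Str → A) → Tree A 2
tree f = node (f ε) (node (f (one false)) (leaf (f (two false false))) (leaf (f (two false true))))
                    (node (f (one true))  (leaf (f (two true false)))  (leaf (f (two true true))))

at : ∀ {A : Set} → Tree A 2 → Str → A
at (node x _ _)                     ε                 = x
at (node _ (node x _ _) _)          (one false)       = x
at (node _ _ (node x _ _))          (one true)        = x
at (node _ (node _ (leaf x) _) _)   (two false false) = x
at (node _ (node _ _ (leaf x)) _)   (two false true)  = x
at (node _ _ (node _ (leaf x) _))   (two true false)  = x
at (node _ _ (node _ _ (leaf x)))   (two true true)   = x

tree-at : ∀ {A : Set} (t : Tree A 2) → tree (at t) ≡ t
tree-at (node _ (node _ (leaf _) (leaf _)) (node _ (leaf _) (leaf _))) = refl

at-plan-leaf : ∀ (w : Tree Bool 2) v a b → at (plan w v) (two a b) ≡ v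
at-plan-leaf (node _ (node _ (leaf _) (leaf _)) (node _ (leaf _) (leaf _))) v false false = refl
at-plan-leaf (node _ (node _ (leaf _) (leaf _)) (node _ (leaf _) (leaf _))) v false true  = refl
at-plan-leaf (node _ (node _ (leaf _) (leaf _)) (node _ (leaf _) (leaf _))) v true  false = refl
at-plan-leaf (node _ (node _ (leaf _) (leaf _)) (node _ (leaf _) (leaf _))) v true  true  = refl

agrees-tree : ∀ (w p a : Str → Bool) → (∀ σ → w σ ≡ true → a σ ≡ p σ) →
              Agrees (tree w) (tree p) (tree a)
agrees-tree w p a ag =
  (ag ε , (ag (one false) , ag (two false false) , ag (two false true))
        , (ag (one true)  , ag (two true false)  , ag (two true true)))

query-tree : ∀ (B : Str → Bool) → query (tree B) ≡ B (two (B ε) (B (one (B ε))))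
query-tree B with B ε
... | false with B (one false)
...   | false = refl
...   | true  = refl
query-tree B | true with B (one true)
...   | false = refl
...   | true  = refl

answer-forced : ∀ {m s} (G : Graph m s) (M : Memory s) u (W : Str → Bool) v →
  forceable (tree W) ≡ true → (∀ σ → W σ ≡ true → M σ (G σ u) ≡ at (plan (tree W) v) σ) →
  answer G M u ≡ v
answer-forced G M u W v forceable-W agrees = begin
  answer G M u ≡⟨ query-tree B ⟨
  query (tree B) ≡⟨ query-plan (tree W) v (tree B) forceable-W
                     (subst (λ t → Agrees (tree W) t (tree B)) (tree-at (plan (tree W) v))
                        (agrees-tree W _ B agrees)) ⟩
  v              ∎
  where
  open ≡-Reasoning
  B : Str → Bool
  B σ = M σ (G σ u)

indicator-not≤0⇒≡true : ∀ {b} → indicator (not b) ≤ 0 → b ≡ true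
indicator-not≤0⇒≡true {true} _ = refl

countOn : List Str → (Str → Bool) → ℕ
countOn H W = sum (map (indicator ∘ W) H)

blocked-tree : ∀ W → blocked (tree W) ≡ countOn allStr (not ∘ W)
blocked-tree W = solve 7
  (λ e a₀ a₁ c₀₀ c₀₁ c₁₀ c₁₁ → e :+ ((a₀ :+ (c₀₀ :+ c₀₁)) :+ (a₁ :+ (c₁₀ :+ c₁₁)))
                             := e :+ (a₀ :+ (a₁ :+ (c₀₀ :+ (c₀₁ :+ (c₁₀ :+ (c₁₁ :+ con 0)))))))
  refl (# ε) (# (one false)) (# (one true))
       (# (two false false)) (# (two false true)) (# (two true false)) (# (two true true))
  where
  open +-*-Solver
  # : Str → ℕ
  # σ = indicator (not (W σ))

countOn-complement : ∀ H W → countOn H W + countOn H (not ∘ W) ≡ length H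
countOn-complement []      W = refl
countOn-complement (σ ∷ H) W with W σ
... | true  = cong suc (countOn-complement H W)
... | false = trans (+-suc (countOn H W) _) (cong suc (countOn-complement H W))

sum-map-mono : ∀ {A : Set} {f g : A → ℕ} (xs : List A) → (∀ x → f x ≤ g x) →
               sum (map f xs) ≤ sum (map g xs)
sum-map-mono []       f≤g = z≤n
sum-map-mono (x ∷ xs) f≤g = +-mono-≤ (f≤g x) (sum-map-mono xs f≤g)

cardOn-++ : ∀ {s} H H′ (X : VSet s) → cardOn (H ++ H′) X ≡ cardOn H X + cardOn H′ X
cardOn-++ H H′ X = trans (cong sum (map-++ (λ σ → ∣ X σ ∣) H H′)) (sum-++ (map (λ σ → ∣ X σ ∣) H) _)

cardOn-∈ : ∀ {s} {H σ} (X : VSet s) → σ ∈ˡ H → ∣ X σ ∣ ≤ cardOn H X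
cardOn-∈ X (Any.here refl) = m≤m+n _ _
cardOn-∈ {H = τ ∷ _} X (Any.there σ∈H) = m≤n⇒m≤o+n (∣ X τ ∣) (cardOn-∈ X σ∈H)

two∈layer3 : ∀ a b → two a b ∈ˡ layer3
two∈layer3 false false = Any.here refl
two∈layer3 false true  = Any.there (Any.here refl)
two∈layer3 true  false = Any.there (Any.there (Any.here refl))
two∈layer3 true  true  = Any.there (Any.there (Any.there (Any.here refl)))

module _ {m s} (G : Graph m s) (W val : Fin m → Str → Bool) where

  Consistent : Set
  Consistent =
    ∀ {u u′ σ} → W u σ ≡ true → W u′ σ ≡ true → G σ u ≡ G σ u′ → val u σ ≡ val u′ σ

  memory : Memory s
  memory σ j with any? (λ u → (W u σ ≟ᵇ true) ×-dec (G σ u ≟ᶠ j))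
  ... | yes (u , _) = val u σ
  ... | no _        = false

  memory-written : Consistent → ∀ u σ → W u σ ≡ true → memory σ (G σ u) ≡ val u σ
  memory-written consistent u σ w with any? (λ u′ → (W u′ σ ≟ᵇ true) ×-dec (G σ u′ ≟ᶠ G σ u))
  ... | yes (u′ , w′ , e) = consistent w′ w e
  ... | no nobody         = contradiction (u , w , refl) nobody

data Internal : Str → Set where
  root  : Internal ε
  inner : ∀ b → Internal (one b)

consistent-by-layers : ∀ {m s} (G : Graph m s) (W : Fin m → Str → Bool) (v : Fin m → Bool) →
  (∀ {u u′ σ} → Internal σ → W u σ ≡ true → W u′ σ ≡ true → G σ u ≡ G σ u′ → u ≡ u′) →
  (∀ {u u′ a b} → W u (two a b) ≡ true → W u′ (two a b) ≡ true →
     G (two a b) u ≡ G (two a b) u′ → v u ≡ v u′) →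
  Consistent G W (λ u → at (plan (tree (W u)) (v u)))
consistent-by-layers G W v internal-unique leaf-agree {σ = ε} w w′ e =
  cong (λ u → at (plan (tree (W u)) (v u)) ε) (internal-unique root w w′ e)
consistent-by-layers G W v internal-unique leaf-agree {σ = one b} w w′ e =
  cong (λ u → at (plan (tree (W u)) (v u)) (one b)) (internal-unique (inner b) w w′ e)
consistent-by-layers G W v internal-unique leaf-agree {u} {u′} {two a b} w w′ e = begin
  at (plan (tree (W u)) (v u)) (two a b)     ≡⟨ at-plan-leaf (tree (W u)) (v u) a b ⟩
  v u                                        ≡⟨ leaf-agree w w′ e ⟩
  v u′                                       ≡⟨ at-plan-leaf (tree (W u′)) (v u′) a b ⟨
  at (plan (tree (W u′)) (v u′)) (two a b)   ∎
  where open ≡-Reasoning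

satisfiable-by-masks : ∀ {m s} (G : Graph m s) (S : Subset m) (W : Fin m → Str → Bool) →
  (∀ u → forceable (tree (W u)) ≡ true) →
  Consistent G W (λ u → at (plan (tree (W u)) (does (u ∈? S)))) →
  Satisfiable G S
satisfiable-by-masks {m} {s} G S W forceable-W consistent =
  M , λ x → mk⇔ (λ answer≡true → from-does (x ∈? S) (trans (sym (answer≡ x)) answer≡true))
                (λ x∈S → trans (answer≡ x) (dec-true (x ∈? S) x∈S))
  where
  val : Fin m → Str → Bool
  val u = at (plan (tree (W u)) (does (u ∈? S)))
  M : Memory s
  M = memory G W val
  answer≡ : ∀ x → answer G M x ≡ does (x ∈? S)
  answer≡ x = answer-forced G M x (W x) _ (forceable-W x) (memory-written G W val consistent x)

-- Peeling

Peelable : ∀ {m s} → Graph m s → Subset m → Subset m → Fin m → Set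
Peelable G S R y =
  cardOn layer3 (Γ G ⁅ y ⁆ ∩V Γ G S) ≡ 0
  ⊎ (cardOn layer3 (Γ G ⁅ y ⁆ ∩V Γ G S) ≡ 1
     × cardOn layer12 (Γ G ⁅ y ⁆ ∩V Γ G ((R ∪ S) - y)) ≤ 1)

-- The elements of R ─ core are removed one at a time by P2, before y being the set y was
-- removed from; of two removed elements the later one lies in the before-set of the other.
record Peeling {m s} (G : Graph m s) (S : Subset m) (c : ℤ) (R : Subset m) : Set where
  field
    core        : Subset m
    core⊆R      : core ⊆ R
    ∣core∣≤c    : ℤ.+ ∣ core ∣ ℤ.≤ c
    before      : Fin m → Subset m
    core⊆before : ∀ {y} → y ∈ R ─ core → core ⊆ before y
    peelable    : ∀ {y} → y ∈ R ─ core → Peelable G S (before y) y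
    nested      : ∀ {y y′} → y ∈ R ─ core → y′ ∈ R ─ core → y ≢ y′ →
                  y′ ∈ before y ⊎ y ∈ before y′

peel : ∀ {m s} (G : Graph m s) {n c} → P2 G n c → (S : Subset m) → ∣ S ∣ ≤ n →
       ∀ fuel R → ∣ R ∣ < fuel → R ⊆ ∁ S → Peeling G S c R
peel {m} G {c = c} p2 S ∣S∣≤n (suc fuel) R (s≤s ∣R∣≤fuel) R⊆∁S with ℤ.+ ∣ R ∣ ℤₚ.≤? c
... | yes ∣R∣≤c = record
  { core = R ; core⊆R = id ; ∣core∣≤c = ∣R∣≤c ; before = λ _ → R
  ; core⊆before = ⊥-elim ∘ x∉p─p R ; peelable = ⊥-elim ∘ x∉p─p R
  ; nested = λ y∈ → ⊥-elim (x∉p─p R y∈) }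
... | no ∣R∣≰c with p2 S ∣S∣≤n R R⊆∁S (ℤₚ.≰⇒> ∣R∣≰c)
...   | y , y∈R , peelable-y = record
  { core = Q.core ; core⊆R = R-y⊆R ∘ Q.core⊆R ; ∣core∣≤c = Q.∣core∣≤c ; before = before
  ; core⊆before = core⊆before ; peelable = peelable ; nested = nested }
  where
  R-y⊆R : R - y ⊆ R
  R-y⊆R = p─q⊆p R ⁅ y ⁆

  module Q = Peeling (peel G p2 S ∣S∣≤n fuel (R - y)
                        (<-≤-trans (x∈p⇒∣p-x∣<∣p∣ y∈R) ∣R∣≤fuel) (R⊆∁S ∘ R-y⊆R))

  remaining : ∀ {z} → z ∈ R ─ Q.core → z ≢ y → z ∈ (R - y) ─ Q.core
  remaining z∈ z≢y = x∈p∧x∉q⇒x∈p─q (x∈p∧x≢y⇒x∈p-y (p─q⊆p _ _ z∈) z≢y) (x∈p─q⇒x∉q _ _ z∈)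

  before : Fin m → Subset m
  before z with z ≟ᶠ y
  ... | yes _ = R
  ... | no _  = Q.before z

  core⊆before : ∀ {z} → z ∈ R ─ Q.core → Q.core ⊆ before z
  core⊆before {z} z∈ with z ≟ᶠ y
  ... | yes _  = R-y⊆R ∘ Q.core⊆R
  ... | no z≢y = Q.core⊆before (remaining z∈ z≢y)

  peelable : ∀ {z} → z ∈ R ─ Q.core → Peelable G S (before z) z
  peelable {z} z∈ with z ≟ᶠ y
  ... | yes refl = peelable-y
  ... | no z≢y   = Q.peelable (remaining z∈ z≢y)

  nested : ∀ {z z′} → z ∈ R ─ Q.core → z′ ∈ R ─ Q.core → z ≢ z′ → z′ ∈ before z ⊎ z ∈ before z′
  nested {z} {z′} z∈ z′∈ z≢z′ with z ≟ᶠ y | z′ ≟ᶠ y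
  ... | yes refl | yes refl = contradiction refl z≢z′
  ... | yes refl | no _     = inj₁ (p─q⊆p R Q.core z′∈)
  ... | no _     | yes refl = inj₂ (p─q⊆p R Q.core z∈)
  ... | no z≢y   | no z′≢y  = Q.nested (remaining z∈ z≢y) (remaining z′∈ z′≢y) z≢z′

-- The memory for S

module Construction {m s n : ℕ} (G : Graph m s) {c : ℤ} (p1 : P1 G n c) (p2 : P2 G n c)
                    (S : Subset m) (∣S∣≤n : ∣ S ∣ ≤ n) where

  abstract
    peeling : Peeling G S c (∁ S)
    peeling = peel G p2 S ∣S∣≤n (suc ∣ ∁ S ∣) (∁ S) ≤-refl id

  open Peeling peeling

  T : Subset m
  T = S ∪ core

  ∣X∩T∣≤n+c : ∀ X → ℤ.+ ∣ X ∩ T ∣ ℤ.≤ ℤ.+ n ℤ.+ c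
  ∣X∩T∣≤n+c X = ℤₚ.≤-trans (ℤ.+≤+ (begin
    ∣ X ∩ T ∣        ≤⟨ ∣p∩q∣≤∣q∣ X T ⟩
    ∣ T ∣            ≤⟨ ∣p∪q∣≤∣p∣+∣q∣ S core ⟩
    ∣ S ∣ + ∣ core ∣ ≤⟨ +-monoˡ-≤ (∣ core ∣) ∣S∣≤n ⟩
    n + ∣ core ∣     ∎)) (ℤₚ.+-monoʳ-≤ (ℤ.+ n) ∣core∣≤c)
    where open ≤-Reasoning

  peeled : ∀ {y} → y ∉ T → y ∈ ∁ S ─ core
  peeled y∉T = x∈p∧x∉q⇒x∈p─q (x∉p⇒x∈∁p (y∉T ∘ x∈p∪q⁺ ∘ inj₁)) (y∉T ∘ x∈p∪q⁺ ∘ inj₂)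

  N : Subset m → Subset (7 * s)
  N X = flatten (Γ G X)

  N-mono : ∀ {X Y} → X ⊆ Y → N X ⊆ N Y
  N-mono X⊆Y = flatten-mono (λ σ → img-mono (G σ) X⊆Y)

  N-∪ : ∀ X Y → N (X ∪ Y) ⊆ N X ∪ N Y
  N-∪ X Y {x} x∈ with cell-surjective {s} x
  ... | σ , j , refl = x∈p∪q⁺ ([ inj₁ ∘ ∈-flatten⁺ (Γ G X) , inj₂ ∘ ∈-flatten⁺ (Γ G Y) ]′
                                (x∈p∪q⁻ _ _ (img-∪ (G σ) X Y (∈-flatten⁻ (Γ G (X ∪ Y)) x∈))))

  open Hall N N-mono N-∪

  demand : Fin m → ℕ
  demand = restrict (λ _ → 5) T

  hall-condition : HallCondition demand ⊤
  hall-condition X = begin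
    weight demand X             ≡⟨ weight-restrict _ T X ⟩
    weight (λ _ → 5) (X ∩ T)    ≡⟨ weight-const 5 (X ∩ T) ⟩
    5 * ∣ X ∩ T ∣               ≤⟨ p1 (X ∩ T) (∣X∩T∣≤n+c X) ⟩
    cardOn allStr (Γ G (X ∩ T)) ≡⟨ ∣flatten∣≡cardOn (Γ G (X ∩ T)) ⟨
    ∣ N (X ∩ T) ∣               ≤⟨ p⊆q⇒∣p∣≤∣q∣ (N-mono (p∩q⊆p X T)) ⟩
    ∣ N X ∣                     ≡⟨ cong ∣_∣ (∩-identityʳ (N X)) ⟨
    ∣ N X ∩ ⊤ ∣                 ∎
    where open ≤-Reasoning

  abstract
    assignment : Assignment demand ⊤
    assignment = hall demand ⊤ hall-condition

  open Assignment assignment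

  F-cell : ∀ {x σ j} → cell σ j ∈ F x → G σ x ≡ j
  F-cell {x} {σ} c∈ = img-⁅⁆ (G σ) (∈-flatten⁻ (Γ G ⁅ x ⁆) (proj₁ (x∈p∩q⁻ _ _ (F⊆ x c∈))))

  coreMask : Fin m → Str → Bool
  coreMask x σ = does (cell σ (G σ x) ∈? F x)

  -- An element of T writes the cells Hall's theorem gives it; a peeled y writes its inner
  -- cells seen by no element of (before y ∪ S) - y, and its leaves outside Γ(S).
  avoid : Fin m → Str → Subset m
  avoid y ε         = (before y ∪ S) - y
  avoid y (one _)   = (before y ∪ S) - y
  avoid y (two _ _) = S

  peelMask : Fin m → Str → Bool
  peelMask y σ = not (does (G σ y ∈? Γ G (avoid y σ) σ))

  mask : Fin m → Str → Bool
  mask u = if does (u ∈? T) then coreMask u else peelMask u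

  owned : Fin m → VSet s
  owned x σ = if coreMask x σ then ⁅ G σ x ⁆ else ⊥

  F⊆owned : ∀ x → F x ⊆ flatten (owned x)
  F⊆owned x {c′} c′∈ with cell-surjective {s} c′
  ... | σ , j , refl with F-cell {x} {σ} {j} c′∈
  ...   | refl = ∈-flatten⁺ (owned x)
    (subst (λ b → G σ x ∈ (if b then ⁅ G σ x ⁆ else ⊥))
           (sym (dec-true (cell σ (G σ x) ∈? F x) c′∈)) (x∈⁅x⁆ (G σ x)))

  ∣owned∣ : ∀ x σ → ∣ owned x σ ∣ ≡ indicator (coreMask x σ)
  ∣owned∣ x σ with coreMask x σ
  ... | true  = ∣⁅x⁆∣≡1 (G σ x)
  ... | false = ∣⊥∣≡0 s

  core-forceable : ∀ {x} → x ∈ T → forceable (tree (coreMask x)) ≡ true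
  core-forceable {x} x∈T = few-blocked⇒forceable (tree W) (begin
    blocked (tree W)                   ≡⟨ blocked-tree W ⟩
    countOn allStr (not ∘ W)           ≡⟨ m+n∸m≡n (countOn allStr W) _ ⟨
    countOn allStr W + countOn allStr (not ∘ W) ∸ countOn allStr W
                                       ≡⟨ cong (_∸ countOn allStr W) (countOn-complement allStr W) ⟩
    7 ∸ countOn allStr W               ≤⟨ ∸-monoʳ-≤ 7 5≤count ⟩
    2                                  ∎)
    where
    open ≤-Reasoning
    W : Str → Bool
    W = coreMask x
    5≤count : 5 ≤ countOn allStr W
    5≤count = begin
      5                       ≡⟨ restrict-∈ (λ _ → 5) x∈T ⟨
      demand x                ≤⟨ d≤∣F∣ x ⟩
      ∣ F x ∣                 ≤⟨ p⊆q⇒∣p∣≤∣q∣ (F⊆owned x) ⟩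
      ∣ flatten (owned x) ∣   ≡⟨ ∣flatten∣≡cardOn (owned x) ⟩
      cardOn allStr (owned x) ≡⟨ cong sum (map-cong (∣owned∣ x) allStr) ⟩
      countOn allStr W        ∎

  clash : Fin m → VSet s
  clash y σ = Γ G ⁅ y ⁆ σ ∩ Γ G (avoid y σ) σ

  blocked≤clash : ∀ y σ → indicator (not (peelMask y σ)) ≤ ∣ clash y σ ∣
  blocked≤clash y σ with G σ y ∈? Γ G (avoid y σ) σ
  ... | yes hit = x∈p⇒0<∣p∣ (x∈p∩q⁺ (∈-img⁺ (G σ) (x∈⁅x⁆ y) , hit))
  ... | no _    = z≤n

  leaf-writable : ∀ {y} → cardOn layer3 (clash y) ≡ 0 → ∀ a b → peelMask y (two a b) ≡ true
  leaf-writable {y} none a b = indicator-not≤0⇒≡true (begin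
    indicator (not (peelMask y (two a b))) ≤⟨ blocked≤clash y (two a b) ⟩
    ∣ clash y (two a b) ∣                  ≤⟨ cardOn-∈ (clash y) (two∈layer3 a b) ⟩
    cardOn layer3 (clash y)                ≡⟨ none ⟩
    0                                      ∎)
    where open ≤-Reasoning

  peel-forceable : ∀ {y} → y ∉ T → forceable (tree (peelMask y)) ≡ true
  peel-forceable {y} y∉T with peelable (peeled y∉T)
  ... | inj₁ none = leaves-writable⇒forceable (tree (peelMask y))
    ((leaf-writable none false false , leaf-writable none false true) ,
     (leaf-writable none true false , leaf-writable none true true))
  ... | inj₂ (one-leaf , few-inner) = few-blocked⇒forceable (tree (peelMask y)) (begin
    blocked (tree (peelMask y))       ≡⟨ blocked-tree (peelMask y) ⟩
    countOn allStr (not ∘ peelMask y) ≤⟨ sum-map-mono allStr (blocked≤clash y) ⟩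
    cardOn allStr (clash y)           ≡⟨ cardOn-++ layer12 layer3 (clash y) ⟩
    cardOn layer12 (clash y) + cardOn layer3 (clash y)
                                      ≤⟨ +-mono-≤ few-inner (≤-reflexive one-leaf) ⟩
    2                                 ∎)
    where open ≤-Reasoning

  mask-forceable : ∀ u → forceable (tree (mask u)) ≡ true
  mask-forceable u with u ∈? T
  ... | yes u∈T = core-forceable u∈T
  ... | no u∉T  = peel-forceable u∉T

  core-unique : ∀ {u u′ σ} → coreMask u σ ≡ true → coreMask u′ σ ≡ true →
                G σ u ≡ G σ u′ → u ≡ u′
  core-unique {u} {u′} {σ} w w′ e = F-disjoint (from-does (cell σ (G σ u) ∈? F u) w)
    (subst (λ j → cell σ j ∈ F u′) (sym e) (from-does (cell σ (G σ u′) ∈? F u′) w′))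

  peel-avoids : ∀ {y z σ} → peelMask y σ ≡ true → z ∈ avoid y σ → G σ z ≢ G σ y
  peel-avoids {y} {z} {σ} w z∈ e with G σ y ∈? Γ G (avoid y σ) σ
  ... | yes _   = contradiction w λ ()
  ... | no miss = miss (subst (_∈ Γ G (avoid y σ) σ) e (∈-img⁺ (G σ) z∈))

  avoid-internal : ∀ {y z σ} → Internal σ → z ∈ (before y ∪ S) - y → z ∈ avoid y σ
  avoid-internal root      z∈ = z∈
  avoid-internal (inner _) z∈ = z∈

  T⊆avoid : ∀ {u y} → u ∈ T → y ∉ T → u ∈ (before y ∪ S) - y
  T⊆avoid {u} {y} u∈T y∉T = x∈p∧x≢y⇒x∈p-y
    ([ x∈p∪q⁺ ∘ inj₂ , x∈p∪q⁺ ∘ inj₁ ∘ core⊆before (peeled y∉T) ]′ (x∈p∪q⁻ S core u∈T))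
    (λ { refl → y∉T u∈T })

  internal-unique : ∀ {u u′ σ} → Internal σ → mask u σ ≡ true → mask u′ σ ≡ true →
                    G σ u ≡ G σ u′ → u ≡ u′
  internal-unique {u} {u′} {σ} int w w′ e with u ∈? T | u′ ∈? T
  ... | yes _   | yes _    = core-unique w w′ e
  ... | yes u∈T | no u′∉T  = contradiction e (peel-avoids w′ (avoid-internal int (T⊆avoid u∈T u′∉T)))
  ... | no u∉T  | yes u′∈T =
    contradiction (sym e) (peel-avoids w (avoid-internal int (T⊆avoid u′∈T u∉T)))
  ... | no u∉T  | no u′∉T with u ≟ᶠ u′
  ...   | yes u≡u′ = u≡u′
  ...   | no u≢u′  = ⊥-elim ([ (λ u′∈ → peel-avoids w (before⊆avoid u′∈ (u≢u′ ∘ sym)) (sym e))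
                             , (λ u∈ → peel-avoids w′ (before⊆avoid u∈ u≢u′) e) ]′
                             (nested (peeled u∉T) (peeled u′∉T) u≢u′))
    where
    before⊆avoid : ∀ {z y} → z ∈ before y → z ≢ y → z ∈ avoid y σ
    before⊆avoid z∈ z≢y = avoid-internal int (x∈p∧x≢y⇒x∈p-y (x∈p∪q⁺ (inj₁ z∈)) z≢y)

  S-transfer : ∀ {u u′ a b} → mask u (two a b) ≡ true → mask u′ (two a b) ≡ true →
               G (two a b) u ≡ G (two a b) u′ → u ∈ S → u′ ∈ S
  S-transfer {u} {u′} w w′ e u∈S with u ∈? T | u′ ∈? T
  ... | no u∉T | _     = contradiction (x∈p∪q⁺ (inj₁ u∈S)) u∉T
  ... | yes _  | yes _ = subst (_∈ S) (core-unique w w′ e) u∈S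
  ... | yes _  | no _  = contradiction e (peel-avoids w′ u∈S)

  leaf-agree : ∀ {u u′ a b} → mask u (two a b) ≡ true → mask u′ (two a b) ≡ true →
               G (two a b) u ≡ G (two a b) u′ → does (u ∈? S) ≡ does (u′ ∈? S)
  leaf-agree {u} {u′} w w′ e =
    does-⇔ (mk⇔ (S-transfer w w′ e) (S-transfer w′ w (sym e))) (u ∈? S) (u′ ∈? S)

  satisfiable : Satisfiable G S
  satisfiable = satisfiable-by-masks G S mask mask-forceable
    (consistent-by-layers G mask (λ u → does (u ∈? S)) internal-unique leaf-agree)

-- Any c works here; c = ⌈ n lg(2m/n) ⌉ only matters for the existence of admissible graphs.
lemma4 : (m s n : ℕ) (G : Graph m s) (c : ℤ) → IsCeilNLg n m c →
    Admissible G n c →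
    (S : Subset m) → ∣ S ∣ ≤ n → Satisfiable G S
lemma4 m s n G c _ (p1 , p2) S ∣S∣≤n = Construction.satisfiable G p1 p2 S ∣S∣≤n
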